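{- Let $\Pi=\{n\ge 1:\gcd(n,6)=1\}$. For every $k\ge 1$ and every vector $(\mathfrak o_1,\dots,\mathfrak o_k)$ of positive integers with $\mathfrak s=\mathfrak o_1+\cdots+\mathfrak o_k$: (1) the set $\Sigma(\mathfrak o_1,\dots,\mathfrak o_k)=\{n\in\Pi: V^{[k]}(n)=(\mathfrak o_1,\dots,\mathfrak o_k)\}$ has a $\Pi$-natural density, and $$\mathbb D_\Pi\big(\Sigma(\mathfrak o_1,\dots,\mathfrak o_k)\big)=2^{ -\mathfrak s}=2^{ -\mathfrak o_1}2^{ -\mathfrak o_2}\cdots 2^{ -\mathfrak o_k};$$ (2) if $\mathfrak p_1,\dots,\mathfrak p_k$ are independent random variables, each geometrically distributed with parameter $\tfrac12$ (i.e. $\mathbb P[\mathfrak p_j=m]=(\tfrac12)^{m-1}\cdot\tfrac12$ for $m=1,2,\dots$), so that $\mathbb E[\mathfrak p_j]=2$ and $\mathrm{Var}[\mathfrak p_j]=2$, then $$\mathbb P[\mathfrak p_1=\mathfrak o_1,\dots,\mathfrak p_k=\mathfrak o_k]=\mathbb D_\Pi\big(\Sigma(\mathfrak o_1,\dots,\mathfrak o_k)\big).$$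
   Context: For an odd integer $n$ let $\mathfrak o(n)=\mathrm{ord}_2(3n+1)$ (the exponent of the largest power of $2$ dividing $3n+1$), and let the accelerated $3x+1$ map be $U(n)=(3n+1)/2^{\mathfrak o(n)}$; it maps odd integers to integers prime to $6$. For $n\in\Pi$ and $j\ge1$ set $\mathfrak o_j(n)=\mathfrak o(U^{(j-1)}(n))$, where $U^{(i)}$ is the $i$-th iterate ($U^{(0)}=\mathrm{id}$), and let $V^{[k]}(n)=(\mathfrak o_1(n),\dots,\mathfrak o_k(n))$. For $\Sigma\subset\Pi$, its $\Pi$-natural density is $\mathbb D_\Pi(\Sigma)=\lim_{t\to\infty}\frac{3}{t}\#\{n\in\Sigma:n\le t\}$ when the limit exists. -}

module Defs where

open import Data.Nat as ℕ using (ℕ; zero; suc; _+_; _*_; _∸_; _^_; _≤_; _≤?_; _≟_)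
open import Data.Nat.DivMod using (_/_; _%_)
open import Data.Nat.GCD using (gcd)
open import Data.Nat.Properties using (m^n≢0)
open import Data.Integer using (+_)
open import Data.Rational as ℚ using (ℚ; 1ℚ; ½; 0ℚ; ∣_∣) renaming (_*_ to _*ℚ_; _-_ to _-ℚ_; _<_ to _<ℚ_)
open import Data.Vec using (Vec; []; _∷_; foldr′)
import Data.Vec.Properties as VecP
open import Data.List using (List; length; filter; upTo)
open import Data.Product using (Σ; ∃; _×_; _,_)
open import Relation.Nullary.Decidable using (_×-dec_)

-- 2-adic valuation ord₂(m), computed with fuel (fuel m suffices; ord₂ 0 = 0 by convention, unused)
ord₂-fuel : ℕ → ℕ → ℕ
ord₂-fuel zero    m = 0
ord₂-fuel (suc f) zero = 0
ord₂-fuel (suc f) (suc m) with (suc m) % 2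
... | zero  = suc (ord₂-fuel f (suc m / 2))
... | suc _ = 0

ord₂ : ℕ → ℕ
ord₂ m = ord₂-fuel m m

𝔬 : ℕ → ℕ
𝔬 n = ord₂ (3 * n + 1)

U : ℕ → ℕ
U n = _/_ (3 * n + 1) (2 ^ 𝔬 n) {{m^n≢0 2 (𝔬 n)}}

V : (k : ℕ) → ℕ → Vec ℕ k
V zero    n = []
V (suc k) n = 𝔬 n ∷ V k (U n)

countΣ : {k : ℕ} → Vec ℕ k → ℕ → ℕ
countΣ {k} os t =
  length (filter (λ n → (1 ≤? n) ×-dec ((gcd n 6 ≟ 1) ×-dec VecP.≡-dec _≟_ (V k n) os)) (upTo (suc t)))

-- Π-natural density: lim_{t→∞} (3/t)·#{n ∈ Σ : n ≤ t} = d   (limit along integers t = m+1)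
HasΠDensity : (ℕ → ℕ) → ℚ → Set
HasΠDensity count d =
  (ε : ℚ) → 0ℚ <ℚ ε → ∃ λ N → (m : ℕ) → N ≤ m →
    ∣ ((+ (3 * count (suc m))) ℚ./ suc m) -ℚ d ∣ <ℚ ε

_^ℚ_ : ℚ → ℕ → ℚ
q ^ℚ zero  = 1ℚ
q ^ℚ suc n = q *ℚ (q ^ℚ n)

geomPMF : ℕ → ℚ
geomPMF m = (½ ^ℚ (m ∸ 1)) *ℚ ½

-- joint pmf of k independent geometric(1/2) variables at (o₁,…,oₖ): product of marginals
jointGeomPMF : {k : ℕ} → Vec ℕ k → ℚ
jointGeomPMF os = foldr′ (λ o acc → geomPMF o *ℚ acc) 1ℚ os

vsum : {k : ℕ} → Vec ℕ k → ℕ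
vsum os = foldr′ _+_ 0 os

-- The odd n with V^[k](n) = (o₁,…,oₖ) form one residue class modulo 2^(s+1), s = o₁ + ⋯ + oₖ.
-- Inductively, if the odd m with V^[k-1](m) = (o₂,…,oₖ) are the class r′ modulo N, then
-- "𝔬(n) = o₁ and U(n) ≡ r′ (mod N)" says exactly that 3n + 1 = 2^𝔬(n)·U(n) is congruent to
-- 2^o₁·r′ modulo 2^o₁·N (the exponent is recovered because U(n) and r′ + qN are odd), and as 3 is
-- invertible modulo a power of 2 this is a single class r of n. Membership in Π adds 3 ∤ n, and since
-- M = 2^(s+1) is prime to 3 exactly two of r, r + M, r + 2M are prime to 3: the set has period 3M
-- with two elements per period, so #{n ≤ t in it} = t/(3·2^s) + O(2^s), whence Π-density 2^(-s),
-- which is also the product of the geometric probabilities 2^(-oⱼ).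
module Submission where

open import Data.Bool using (if_then_else_)
open import Data.Empty using (⊥-elim)
open import Data.Integer as ℤ using (-[1+_]; +[1+_]; _⊖_)
import Data.Integer.Properties as ℤ
open import Data.List using (length; filter; applyUpTo; upTo)
open import Data.List.Properties using (filter-≐)
open import Data.Nat
open import Data.Nat.Coprimality using (Coprime; coprime⇒gcd≡1)
open import Data.Nat.Divisibility
  using (_∣_; divides; _∣?_; ∣-trans; ∣⇒≤; ∣1⇒≡1; n∣m⇒m%n≡0; m%n≡0⇒n∣m)
open import Data.Nat.DivMod
open import Data.Nat.GCD using (gcd; gcd-greatest)
open import Data.Nat.Properties
open import Data.Nat.Tactic.RingSolver using (solve-∀)
open import Data.Product using (_×_; _,_; proj₁; proj₂; ∃-syntax)
open import Data.Product.Function.NonDependent.Propositional using (_×-⇔_)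
open import Data.Rational as ℚ using (ℚ; mkℚ; toℚᵘ; ½)
import Data.Rational.Properties as ℚ
open import Data.Rational.Unnormalised as ℚᵘ using (mkℚᵘ; *<*)
  renaming (_≃_ to _≃ᵘ_; _<_ to _<ᵘ_)
import Data.Rational.Unnormalised.Properties as ℚᵘ
open import Data.Sum using (_⊎_; inj₁; inj₂)
open import Data.Vec using (Vec; []; _∷_)
import Data.Vec.Properties as Vec
open import Data.Vec.Relation.Unary.All using (All; []; _∷_)
open import Function.Base using (id)
open import Function.Bundles using (_⇔_; mk⇔; Equivalence)
import Function.Properties.Equivalence as ⇔
open import Function.Related.Propositional using (module EquationalReasoning; equivalence)
open import Level using (Level)
open import Relation.Binary.PropositionalEquality
open import Relation.Nullary using (Dec; yes; no; does; ¬_; ¬?)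
open import Relation.Nullary.Decidable using (_×-dec_; does-⇔; from-no)
open import Relation.Unary using (Pred; Decidable)

open import Defs

-- Odd parts

[2*n]%2≡0 : ∀ n → (2 * n) % 2 ≡ 0
[2*n]%2≡0 n = trans (%-congˡ (*-comm 2 n)) (m*n%n≡0 n 2)

odd≢2* : ∀ {y} w → y % 2 ≡ 1 → y ≢ 2 * w
odd≢2* w y-odd refl = 0≢1+n (trans (sym ([2*n]%2≡0 w)) y-odd)

n%2≢0⇒n%2≡1 : ∀ n → n % 2 ≢ 0 → n % 2 ≡ 1
n%2≢0⇒n%2≡1 n n%2≢0 with n % 2 | m%n<n n 2
... | 0           | _ = ⊥-elim (n%2≢0 refl)
... | 1           | _ = refl
... | suc (suc _) | s≤s (s≤s ())

even⇒≡2*half : ∀ n → n % 2 ≡ 0 → n ≡ 2 * (n / 2)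
even⇒≡2*half n even = begin
  n                   ≡⟨ m≡m%n+[m/n]*n n 2 ⟩
  n % 2 + n / 2 * 2   ≡⟨ cong (_+ n / 2 * 2) even ⟩
  n / 2 * 2           ≡⟨ *-comm (n / 2) 2 ⟩
  2 * (n / 2)         ∎
  where open ≡-Reasoning

[3n+1]%2≡0⇒n%2≡1 : ∀ n → (3 * n + 1) % 2 ≡ 0 → n % 2 ≡ 1
[3n+1]%2≡0⇒n%2≡1 n 3n+1-even = n%2≢0⇒n%2≡1 n λ n%2≡0 → 0≢1+n (begin
  0                       ≡⟨ 3n+1-even ⟨
  (3 * n + 1) % 2         ≡⟨ cong (λ m → (3 * m + 1) % 2) (even⇒≡2*half n n%2≡0) ⟩
  (3 * (2 * h) + 1) % 2   ≡⟨ cong (_% 2) (rearrange h) ⟩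
  (1 + 3 * h * 2) % 2     ≡⟨ [m+kn]%n≡m%n 1 (3 * h) 2 ⟩
  1                       ∎)
  where
  open ≡-Reasoning
  h = n / 2
  rearrange : ∀ h → 3 * (2 * h) + 1 ≡ 1 + 3 * h * 2
  rearrange = solve-∀

ord₂-fuel-odd-part : ∀ f x → x ≢ 0 → x ≤ f → ∃[ y ] y % 2 ≡ 1 × x ≡ 2 ^ ord₂-fuel f x * y
ord₂-fuel-odd-part f       zero    x≢0 _ = ⊥-elim (x≢0 refl)
ord₂-fuel-odd-part (suc f) (suc m) _   (s≤s m≤f) with suc m % 2 in rem | m%n<n (suc m) 2
... | suc zero    | _ = suc m , rem , sym (*-identityˡ (suc m))
... | suc (suc _) | s≤s (s≤s ())
... | zero        | _ =
  let y , y-odd , half≡ = ord₂-fuel-odd-part f half half≢0 half≤f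
  in y , y-odd , trans x≡2*half (trans (cong (2 *_) half≡) (sym (*-assoc 2 (2 ^ ord₂-fuel f half) y)))
  where
  half = suc m / 2
  x≡2*half : suc m ≡ 2 * half
  x≡2*half = even⇒≡2*half (suc m) rem
  half≢0 : half ≢ 0
  half≢0 half≡0 = 1+n≢0 (trans x≡2*half (cong (2 *_) half≡0))
  half≤f : half ≤ f
  half≤f = ≤-trans (<⇒≤pred (m/n<m (suc m) 2 (s≤s (s≤s z≤n)))) m≤f

U-is-odd-part : ∀ n → U n % 2 ≡ 1 × 3 * n + 1 ≡ 2 ^ 𝔬 n * U n
U-is-odd-part n with ord₂-fuel-odd-part (3 * n + 1) (3 * n + 1) (m+1+n≢0 (3 * n)) ≤-refl
... | y , y-odd , 3n+1≡ =
  subst (λ u → u % 2 ≡ 1) (sym U≡y) y-odd , trans 3n+1≡ (cong (2 ^ 𝔬 n *_) (sym U≡y))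
  where
  instance _ = m^n≢0 2 (𝔬 n)
  U≡y : U n ≡ y
  U≡y = trans (/-congˡ 3n+1≡) (trans (cong (_/ 2 ^ 𝔬 n) (*-comm (2 ^ 𝔬 n) y)) (m*n/n≡m y (2 ^ 𝔬 n)))

2^m*odd-injective : ∀ e o {y z} → y % 2 ≡ 1 → z % 2 ≡ 1 → 2 ^ e * y ≡ 2 ^ o * z → e ≡ o × y ≡ z
2^m*odd-injective zero    zero    _ _ eq = refl , *-cancelˡ-≡ _ _ 1 eq
2^m*odd-injective zero    (suc o) {y} {z} y-odd _ eq =
  ⊥-elim (odd≢2* (2 ^ o * z) y-odd (trans (sym (*-identityˡ y)) (trans eq (*-assoc 2 (2 ^ o) z))))
2^m*odd-injective (suc e) zero    {y} {z} _ z-odd eq =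
  ⊥-elim (odd≢2* (2 ^ e * y) z-odd (trans (sym (*-identityˡ z)) (trans (sym eq) (*-assoc 2 (2 ^ e) y))))
2^m*odd-injective (suc e) (suc o) {y} {z} y-odd z-odd eq =
  let e≡o , y≡z = 2^m*odd-injective e o y-odd z-odd
                    (*-cancelˡ-≡ _ _ 2 (trans (sym (*-assoc 2 (2 ^ e) y)) (trans eq (*-assoc 2 (2 ^ o) z))))
  in cong suc e≡o , y≡z

[m*n]%[m*o]≡m*[n%o] : ∀ m n o .{{_ : NonZero o}} .{{_ : NonZero (m * o)}} →
                      (m * n) % (m * o) ≡ m * (n % o)
[m*n]%[m*o]≡m*[n%o] m n o = begin
  (m * n) % (m * o) ≡⟨ cong (_% (m * o)) (*-comm m n) ⟩
  (n * m) % (m * o) ≡⟨ %-congʳ (*-comm m o) ⟩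
  (n * m) % (o * m) ≡⟨ m%n*o≡m*o%[n*o] n o m ⟨
  n % o * m         ≡⟨ *-comm (n % o) m ⟩
  m * (n % o)       ∎
  where
  open ≡-Reasoning
  instance
    _ = m*n≢0⇒m≢0 m
    _ = m*n≢0 o m

2^e*y%M≡2^o*a⇔ : ∀ e o {y N a M} .{{_ : NonZero N}} .{{_ : NonZero M}} → M ≡ 2 ^ o * N →
                 y % 2 ≡ 1 → 2 ∣ N → a % 2 ≡ 1 → a < N →
                 (e ≡ o × y % N ≡ a) ⇔ ((2 ^ e * y) % M ≡ 2 ^ o * a)
2^e*y%M≡2^o*a⇔ e o {y} {N} {a} {M} M≡ y-odd (divides h N≡h*2) a-odd a<N = mk⇔ to from
  where
  instance
    _ = m^n≢0 2 o
    _ = m*n≢0 (2 ^ o) N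
  to : e ≡ o × y % N ≡ a → (2 ^ e * y) % M ≡ 2 ^ o * a
  to (refl , y%N≡a) = begin
    (2 ^ o * y) % M           ≡⟨ %-congʳ M≡ ⟩
    (2 ^ o * y) % (2 ^ o * N) ≡⟨ [m*n]%[m*o]≡m*[n%o] (2 ^ o) y N ⟩
    2 ^ o * (y % N)           ≡⟨ cong (2 ^ o *_) y%N≡a ⟩
    2 ^ o * a                 ∎
    where open ≡-Reasoning
  from : (2 ^ e * y) % M ≡ 2 ^ o * a → e ≡ o × y % N ≡ a
  from x%M≡ = e≡o , (begin
      y % N           ≡⟨ cong (_% N) y≡ ⟩
      (a + q * N) % N ≡⟨ [m+kn]%n≡m%n a q N ⟩
      a % N           ≡⟨ m<n⇒m%n≡m a<N ⟩
      a               ∎)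
    where
    open ≡-Reasoning
    q = (2 ^ e * y) / M
    x≡ : 2 ^ e * y ≡ 2 ^ o * (a + q * N)
    x≡ = begin
      2 ^ e * y                   ≡⟨ m≡m%n+[m/n]*n (2 ^ e * y) M ⟩
      (2 ^ e * y) % M + q * M     ≡⟨ cong₂ (λ r m → r + q * m) x%M≡ M≡ ⟩
      2 ^ o * a + q * (2 ^ o * N) ≡⟨ distrib (2 ^ o) a q N ⟩
      2 ^ o * (a + q * N)         ∎
      where distrib : ∀ p a q N → p * a + q * (p * N) ≡ p * (a + q * N)
            distrib = solve-∀
    a+qN-odd : (a + q * N) % 2 ≡ 1
    a+qN-odd = begin
      (a + q * N) % 2       ≡⟨ cong (λ n → (a + q * n) % 2) N≡h*2 ⟩
      (a + q * (h * 2)) % 2 ≡⟨ cong (λ n → (a + n) % 2) (sym (*-assoc q h 2)) ⟩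
      (a + q * h * 2) % 2   ≡⟨ [m+kn]%n≡m%n a (q * h) 2 ⟩
      a % 2                 ≡⟨ a-odd ⟩
      1                     ∎
    e≡o : e ≡ o
    e≡o = proj₁ (2^m*odd-injective e o y-odd a+qN-odd x≡)
    y≡ : y ≡ a + q * N
    y≡ = proj₂ (2^m*odd-injective e o y-odd a+qN-odd x≡)

-- Residue classes

module _ {M : ℕ} .{{_ : NonZero M}} where

  %-cong-+ : ∀ {a b c d} → a % M ≡ b % M → c % M ≡ d % M → (a + c) % M ≡ (b + d) % M
  %-cong-+ {a} {b} {c} {d} a≡b c≡d = begin
    (a + c) % M             ≡⟨ %-distribˡ-+ a c M ⟩
    (a % M + c % M) % M     ≡⟨ cong₂ (λ u v → (u + v) % M) a≡b c≡d ⟩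
    (b % M + d % M) % M     ≡⟨ %-distribˡ-+ b d M ⟨
    (b + d) % M             ∎
    where open ≡-Reasoning

  %-cong-* : ∀ {a b c d} → a % M ≡ b % M → c % M ≡ d % M → (a * c) % M ≡ (b * d) % M
  %-cong-* {a} {b} {c} {d} a≡b c≡d = begin
    (a * c) % M             ≡⟨ %-distribˡ-* a c M ⟩
    (a % M * (c % M)) % M   ≡⟨ cong₂ (λ u v → (u * v) % M) a≡b c≡d ⟩
    (b % M * (d % M)) % M   ≡⟨ %-distribˡ-* b d M ⟨
    (b * d) % M             ∎
    where open ≡-Reasoning

ResidueClass : (M : ℕ) .{{_ : NonZero M}} → Pred ℕ Level.zero → Set
ResidueClass M P = ∃[ r ] r < M × (∀ n → P n ⇔ n % M ≡ r)

2^n%3≡1⊎2 : ∀ n → 2 ^ n % 3 ≡ 1 ⊎ 2 ^ n % 3 ≡ 2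
2^n%3≡1⊎2 zero = inj₁ refl
2^n%3≡1⊎2 (suc n) with 2^n%3≡1⊎2 n
... | inj₁ ≡1 = inj₂ (trans (%-distribˡ-* 2 (2 ^ n) 3) (cong (λ r → (2 * r) % 3) ≡1))
... | inj₂ ≡2 = inj₁ (trans (%-distribˡ-* 2 (2 ^ n) 3) (cong (λ r → (2 * r) % 3) ≡2))

3-invertible-mod : ∀ M .{{_ : NonZero M}} → M % 3 ≡ 1 ⊎ M % 3 ≡ 2 → ∃[ i ] (3 * i) % M ≡ 1 % M
3-invertible-mod M (inj₁ M%3≡1) = 2 * (M / 3) + 1 , (begin
    (3 * (2 * t + 1)) % M     ≡⟨ cong (_% M) (rearrange t) ⟩
    (1 + 2 * (1 + t * 3)) % M ≡⟨ cong (λ m → (1 + 2 * m) % M) M≡ ⟨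
    (1 + 2 * M) % M           ≡⟨ [m+kn]%n≡m%n 1 2 M ⟩
    1 % M                     ∎)
  where
  open ≡-Reasoning
  t = M / 3
  M≡ : M ≡ 1 + t * 3
  M≡ = trans (m≡m%n+[m/n]*n M 3) (cong (_+ t * 3) M%3≡1)
  rearrange : ∀ t → 3 * (2 * t + 1) ≡ 1 + 2 * (1 + t * 3)
  rearrange = solve-∀
3-invertible-mod M (inj₂ M%3≡2) = M / 3 + 1 , (begin
    (3 * (t + 1)) % M         ≡⟨ cong (_% M) (rearrange t) ⟩
    (1 + (2 + t * 3)) % M     ≡⟨ cong (λ m → (1 + m) % M) M≡ ⟨
    (1 + M) % M               ≡⟨ [m+n]%n≡m%n 1 M ⟩
    1 % M                     ∎)
  where
  open ≡-Reasoning
  t = M / 3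
  M≡ : M ≡ 2 + t * 3
  M≡ = trans (m≡m%n+[m/n]*n M 3) (cong (_+ t * 3) M%3≡2)
  rearrange : ∀ t → 3 * (t + 1) ≡ 1 + (2 + t * 3)
  rearrange = solve-∀

3n+1-residueClass : ∀ M .{{_ : NonZero M}} → M % 3 ≡ 1 ⊎ M % 3 ≡ 2 → ∀ c →
                    ResidueClass M (λ n → (3 * n + 1) % M ≡ c % M)
3n+1-residueClass M M%3 c = r₀ % M , m%n<n r₀ M , λ n → mk⇔ (to n) (from n)
  where
  open ≡-Reasoning
  i = proj₁ (3-invertible-mod M M%3)
  3i≡1 : (3 * i) % M ≡ 1 % M
  3i≡1 = proj₂ (3-invertible-mod M M%3)
  M-1 = pred M
  -- n ≡ 3⁻¹(c - 1), with M - 1 standing for -1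
  r₀ = i * (c + M-1)
  +M-1 : ∀ x → (x + 1 + M-1) % M ≡ x % M
  +M-1 x = trans (cong (_% M) (trans (+-assoc x 1 M-1) (cong (x +_) (suc-pred M)))) ([m+n]%n≡m%n x M)
  to : ∀ n → (3 * n + 1) % M ≡ c % M → n % M ≡ r₀ % M
  to n 3n+1≡c = begin
    n % M                        ≡⟨ cong (_% M) (*-identityˡ n) ⟨
    (1 * n) % M                  ≡⟨ %-cong-* 3i≡1 refl ⟨
    (3 * i * n) % M              ≡⟨ cong (_% M) (rearrange i n) ⟩
    (i * (3 * n)) % M            ≡⟨ %-cong-* {a = i} refl (+M-1 (3 * n)) ⟨
    (i * (3 * n + 1 + M-1)) % M  ≡⟨ %-cong-* {a = i} refl (%-cong-+ 3n+1≡c refl) ⟩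
    r₀ % M                       ∎
    where rearrange : ∀ i n → 3 * i * n ≡ i * (3 * n)
          rearrange = solve-∀
  from : ∀ n → n % M ≡ r₀ % M → (3 * n + 1) % M ≡ c % M
  from n n≡r₀ = begin
    (3 * n + 1) % M              ≡⟨ %-cong-+ (%-cong-* {a = 3} refl n≡r₀) refl ⟩
    (3 * r₀ + 1) % M             ≡⟨ cong (_% M) (rearrange i (c + M-1)) ⟩
    (3 * i * (c + M-1) + 1) % M  ≡⟨ %-cong-+ (%-cong-* 3i≡1 refl) refl ⟩
    (1 * (c + M-1) + 1) % M      ≡⟨ cong (_% M) (unit c M-1) ⟩
    (c + 1 + M-1) % M            ≡⟨ +M-1 c ⟩
    c % M                        ∎
    where rearrange : ∀ i x → 3 * (i * x) + 1 ≡ 3 * i * x + 1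
          rearrange = solve-∀
          unit : ∀ c m → 1 * (c + m) + 1 ≡ c + 1 + m
          unit = solve-∀

V-suc⇔ : ∀ {k o} {os : Vec ℕ k} n →
         (n % 2 ≡ 1 × V (suc k) n ≡ suc o ∷ os) ⇔ (𝔬 n ≡ suc o × (U n % 2 ≡ 1 × V k (U n) ≡ os))
V-suc⇔ {k} {o} {os} n = mk⇔ to from
  where
  to : n % 2 ≡ 1 × V (suc k) n ≡ suc o ∷ os → 𝔬 n ≡ suc o × (U n % 2 ≡ 1 × V k (U n) ≡ os)
  to (_ , V≡) = let 𝔬≡ , V[Un]≡ = Vec.∷-injective V≡ in 𝔬≡ , proj₁ (U-is-odd-part n) , V[Un]≡
  from : 𝔬 n ≡ suc o × (U n % 2 ≡ 1 × V k (U n) ≡ os) → n % 2 ≡ 1 × V (suc k) n ≡ suc o ∷ os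
  from (𝔬≡ , _ , V[Un]≡) = [3n+1]%2≡0⇒n%2≡1 n 3n+1-even , cong₂ _∷_ 𝔬≡ V[Un]≡
    where
    open ≡-Reasoning
    3n+1-even : (3 * n + 1) % 2 ≡ 0
    3n+1-even = begin
      (3 * n + 1) % 2             ≡⟨ cong (_% 2) (proj₂ (U-is-odd-part n)) ⟩
      (2 ^ 𝔬 n * U n) % 2         ≡⟨ cong (λ e → (2 ^ e * U n) % 2) 𝔬≡ ⟩
      (2 * 2 ^ o * U n) % 2       ≡⟨ cong (_% 2) (*-assoc 2 (2 ^ o) (U n)) ⟩
      (2 * (2 ^ o * U n)) % 2     ≡⟨ [2*n]%2≡0 (2 ^ o * U n) ⟩
      0                           ∎

V-residueClass : ∀ {k} (os : Vec ℕ k) → All (1 ≤_) os →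
                 ResidueClass (2 ^ suc (vsum os)) {{m^n≢0 2 (suc (vsum os))}}
                              (λ n → n % 2 ≡ 1 × V k n ≡ os)
V-residueClass []                 []         = 1 , s≤s (s≤s z≤n) , λ n → mk⇔ proj₁ (_, refl)
V-residueClass {suc k} (o@(suc _) ∷ os) (_ ∷ os≥1) with V-residueClass os os≥1
... | r′ , r′<N , class′ = r , r<M , λ n → begin
    (n % 2 ≡ 1 × V (suc k) n ≡ o ∷ os)
      ∼⟨ V-suc⇔ n ⟩
    (𝔬 n ≡ o × (U n % 2 ≡ 1 × V k (U n) ≡ os))
      ∼⟨ ⇔.refl ×-⇔ class′ (U n) ⟩
    (𝔬 n ≡ o × U n % N ≡ r′)
      ∼⟨ 2^e*y%M≡2^o*a⇔ (𝔬 n) o M≡ (proj₁ (U-is-odd-part n)) 2∣N r′-odd r′<N ⟩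
    ((2 ^ 𝔬 n * U n) % M ≡ c)
      ≡⟨ cong₂ (λ x y → x % M ≡ y) (sym (proj₂ (U-is-odd-part n))) c≡c%M ⟩
    ((3 * n + 1) % M ≡ c % M)
      ∼⟨ proj₂ (proj₂ residue) n ⟩
    n % M ≡ r ∎
  where
  open EquationalReasoning {k = equivalence}
  s′ = vsum os
  N = 2 ^ suc s′
  M = 2 ^ suc (o + s′)
  instance
    _ = m^n≢0 2 o
    _ = m^n≢0 2 (suc s′)
    _ = m^n≢0 2 (suc (o + s′))
  M≡ : M ≡ 2 ^ o * N
  M≡ = trans (cong (2 ^_) (sym (+-suc o s′))) (^-distribˡ-+-* 2 o (suc s′))
  2∣N : 2 ∣ N
  2∣N = divides (2 ^ s′) (*-comm 2 (2 ^ s′))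
  c = 2 ^ o * r′
  c≡c%M : c ≡ c % M
  c≡c%M = sym (m<n⇒m%n≡m (subst (c <_) (sym M≡) (*-monoʳ-< (2 ^ o) r′<N)))
  r′-odd : r′ % 2 ≡ 1
  r′-odd = proj₁ (Equivalence.from (class′ r′) (m<n⇒m%n≡m r′<N))
  residue = 3n+1-residueClass M (2^n%3≡1⊎2 (suc (o + s′))) c
  r = proj₁ residue
  r<M = proj₁ (proj₂ residue)

-- Counting

𝟙 : ∀ {ℓ} {A : Set ℓ} → Dec A → ℕ
𝟙 A? = if does A? then 1 else 0

𝟙-cong : ∀ {a b} {A : Set a} {B : Set b} → A ⇔ B → (A? : Dec A) (B? : Dec B) → 𝟙 A? ≡ 𝟙 B?
𝟙-cong A⇔B A? B? = cong (λ b → if b then 1 else 0) (does-⇔ A⇔B A? B?)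

count : ∀ {ℓ} {P : Pred ℕ ℓ} → Decidable P → ℕ → ℕ
count P? zero    = 0
count P? (suc t) = 𝟙 (P? 0) + count (λ i → P? (suc i)) t

module _ {ℓ : Level} where

  length-filter-applyUpTo : ∀ {P : Pred ℕ ℓ} (P? : Decidable P) f t →
                            length (filter P? (applyUpTo f t)) ≡ count (λ i → P? (f i)) t
  length-filter-applyUpTo P? f zero = refl
  length-filter-applyUpTo P? f (suc t) with P? (f 0)
  ... | yes _ = cong suc (length-filter-applyUpTo P? (λ i → f (suc i)) t)
  ... | no  _ = length-filter-applyUpTo P? (λ i → f (suc i)) t

  count-+ : ∀ {P : Pred ℕ ℓ} (P? : Decidable P) t u →
            count P? (t + u) ≡ count P? t + count (λ i → P? (t + i)) u
  count-+ P? zero    u = refl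
  count-+ P? (suc t) u = trans (cong (𝟙 (P? 0) +_) (count-+ (λ i → P? (suc i)) t u))
                               (sym (+-assoc (𝟙 (P? 0)) _ _))

  count-mono : ∀ {P : Pred ℕ ℓ} (P? : Decidable P) {t u} → t ≤ u → count P? t ≤ count P? u
  count-mono P? {t} {u} t≤u = begin
    count P? t                                        ≤⟨ m≤m+n (count P? t) _ ⟩
    count P? t + count (λ i → P? (t + i)) (u ∸ t)     ≡⟨ count-+ P? t (u ∸ t) ⟨
    count P? (t + (u ∸ t))                            ≡⟨ cong (count P?) (m+[n∸m]≡n t≤u) ⟩
    count P? u                                        ∎
    where open ≤-Reasoning

  count-cong : ∀ {P Q : Pred ℕ ℓ} (P? : Decidable P) (Q? : Decidable Q) → (∀ n → P n ⇔ Q n) →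
               ∀ t → count P? t ≡ count Q? t
  count-cong P? Q? P⇔Q zero    = refl
  count-cong P? Q? P⇔Q (suc t) = cong₂ _+_ (𝟙-cong (P⇔Q 0) (P? 0) (Q? 0))
                                           (count-cong _ _ (λ n → P⇔Q (suc n)) t)

  count-none : ∀ {P : Pred ℕ ℓ} (P? : Decidable P) t → (∀ i → i < t → ¬ P i) → count P? t ≡ 0
  count-none P? zero    _  = refl
  count-none P? (suc t) ¬P with P? 0
  ... | yes P0 = ⊥-elim (¬P 0 z<s P0)
  ... | no  _  = count-none (λ i → P? (suc i)) t (λ i i<t → ¬P (suc i) (s≤s i<t))

  count-unique : ∀ {P : Pred ℕ ℓ} (P? : Decidable P) {t} c → c < t → (∀ i → i < t → P i → i ≡ c) →
                 count P? t ≡ 𝟙 (P? c)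
  count-unique P? {suc t} zero    _         only-c =
    trans (cong (𝟙 (P? 0) +_)
                (count-none (λ i → P? (suc i)) t (λ i i<t Pi → 1+n≢0 (only-c (suc i) (s≤s i<t) Pi))))
          (+-identityʳ _)
  count-unique P? {suc t} (suc c) (s≤s c<t) only-c with P? 0
  ... | yes P0 = ⊥-elim (0≢1+n (only-c 0 z<s P0))
  ... | no  _  = count-unique (λ i → P? (suc i)) c c<t
                   (λ i i<t Pi → suc-injective (only-c (suc i) (s≤s i<t) Pi))

  count-periodic : ∀ {P : Pred ℕ ℓ} (P? : Decidable P) L → (∀ n → P (L + n) ⇔ P n) →
                   ∀ j ρ → count P? (j * L + ρ) ≡ j * count P? L + count P? ρ
  count-periodic P? L periodic zero    ρ = refl
  count-periodic P? L periodic (suc j) ρ = begin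
    count P? ((L + j * L) + ρ)                        ≡⟨ cong (count P?) (+-assoc L (j * L) ρ) ⟩
    count P? (L + (j * L + ρ))                        ≡⟨ count-+ P? L (j * L + ρ) ⟩
    count P? L + count (λ i → P? (L + i)) (j * L + ρ)
      ≡⟨ cong (count P? L +_) (count-cong _ P? periodic (j * L + ρ)) ⟩
    count P? L + count P? (j * L + ρ)
      ≡⟨ cong (count P? L +_) (count-periodic P? L periodic j ρ) ⟩
    count P? L + (j * count P? L + count P? ρ)        ≡⟨ +-assoc (count P? L) _ _ ⟨
    (count P? L + j * count P? L) + count P? ρ        ∎
    where open ≡-Reasoning

  count-approx : ∀ {P : Pred ℕ ℓ} (P? : Decidable P) L .{{_ : NonZero L}} K → (∀ n → P (L + n) ⇔ P n) →
                 count P? L * K ≡ L → ∀ T → ∣ count P? T * K - T ∣ ≤ L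
  count-approx P? L K periodic cL*K≡L T = begin
    ∣ count P? T * K - T ∣            ≡⟨ cong₂ ∣_-_∣ countT*K≡ T≡ ⟩
    ∣ j * L + cρ * K - j * L + ρ ∣    ≡⟨ ∣m+n-m+o∣≡∣n-o∣ (j * L) (cρ * K) ρ ⟩
    ∣ cρ * K - ρ ∣                    ≤⟨ ∣m-n∣≤m⊔n (cρ * K) ρ ⟩
    cρ * K ⊔ ρ                        ≤⟨ ⊔-lub cρ*K≤L (<⇒≤ (m%n<n T L)) ⟩
    L                                 ∎
    where
    open ≤-Reasoning
    j = T / L
    ρ = T % L
    cρ = count P? ρ
    T≡ : T ≡ j * L + ρ
    T≡ = trans (m≡m%n+[m/n]*n T L) (+-comm ρ (j * L))
    countT*K≡ : count P? T * K ≡ j * L + cρ * K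
    countT*K≡ = begin-equality
      count P? T * K                  ≡⟨ cong (λ t → count P? t * K) T≡ ⟩
      count P? (j * L + ρ) * K        ≡⟨ cong (_* K) (count-periodic P? L periodic j ρ) ⟩
      (j * count P? L + cρ) * K       ≡⟨ *-distribʳ-+ K (j * count P? L) cρ ⟩
      j * count P? L * K + cρ * K     ≡⟨ cong (_+ cρ * K) (*-assoc j (count P? L) K) ⟩
      j * (count P? L * K) + cρ * K   ≡⟨ cong (λ x → j * x + cρ * K) cL*K≡L ⟩
      j * L + cρ * K                  ∎
    cρ*K≤L : cρ * K ≤ L
    cρ*K≤L = begin
      cρ * K                          ≤⟨ *-monoˡ-≤ K (count-mono P? (<⇒≤ (m%n<n T L))) ⟩
      count P? L * K                  ≡⟨ cL*K≡L ⟩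
      L                               ∎

-- Members of a residue class prime to 3

𝟙[3∤] : ℕ → ℕ
𝟙[3∤] x = 𝟙 (¬? (x % 3 ≟ 0))

𝟙[3∤]-three-translates : ∀ M r → M % 3 ≡ 1 ⊎ M % 3 ≡ 2 →
                         𝟙[3∤] r + (𝟙[3∤] (M + r) + 𝟙[3∤] (M + (M + r))) ≡ 2
𝟙[3∤]-three-translates M r M%3 = begin
  𝟙[3∤] r + (𝟙[3∤] (M + r) + 𝟙[3∤] (M + (M + r)))
    ≡⟨ cong₂ _+_ (mod3 r u (sym (m%n%n≡m%n r 3)))
                 (cong₂ _+_ (mod3 (M + r) (w + u) (%-distribˡ-+ M r 3))
                            (mod3 (M + (M + r)) (w + (w + u) % 3) M+[M+r]≡)) ⟩
  𝟙[3∤] u + (𝟙[3∤] (w + u) + 𝟙[3∤] (w + (w + u) % 3))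
    ≡⟨ cases (m%n<n r 3) M%3 ⟩
  2 ∎
  where
  open ≡-Reasoning
  u = r % 3
  w = M % 3
  mod3 : ∀ x y → x % 3 ≡ y % 3 → 𝟙[3∤] x ≡ 𝟙[3∤] y
  mod3 x y x≡y = cong (λ z → 𝟙 (¬? (z ≟ 0))) x≡y
  M+[M+r]≡ : (M + (M + r)) % 3 ≡ (w + (w + u) % 3) % 3
  M+[M+r]≡ = trans (%-distribˡ-+ M (M + r) 3) (cong (λ z → (w + z) % 3) (%-distribˡ-+ M r 3))
  cases : ∀ {u w} → u < 3 → w ≡ 1 ⊎ w ≡ 2 →
          𝟙[3∤] u + (𝟙[3∤] (w + u) + 𝟙[3∤] (w + (w + u) % 3)) ≡ 2
  cases {0} _ (inj₁ refl) = refl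
  cases {1} _ (inj₁ refl) = refl
  cases {2} _ (inj₁ refl) = refl
  cases {0} _ (inj₂ refl) = refl
  cases {1} _ (inj₂ refl) = refl
  cases {2} _ (inj₂ refl) = refl
  cases {suc (suc (suc _))} (s≤s (s≤s (s≤s ()))) _

module PrimeTo3InResidueClass (M : ℕ) .{{_ : NonZero M}} (M%3 : M % 3 ≡ 1 ⊎ M % 3 ≡ 2) {r} (r<M : r < M) where

  Member : Pred ℕ Level.zero
  Member n = n % M ≡ r × n % 3 ≢ 0

  member? : Decidable Member
  member? n = (n % M ≟ r) ×-dec ¬? (n % 3 ≟ 0)

  [M+n]%M≡n%M : ∀ n → (M + n) % M ≡ n % M
  [M+n]%M≡n%M n = trans (cong (_% M) (+-comm M n)) ([m+n]%n≡m%n n M)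

  Member-periodic : ∀ n → Member (M + (M + M) + n) ⇔ Member n
  Member-periodic n = mk⇔ (λ (≡r , ≢0) → trans (sym %M) ≡r , λ ≡0 → ≢0 (trans %3 ≡0))
                          (λ (≡r , ≢0) → trans %M ≡r , λ ≡0 → ≢0 (trans (sym %3) ≡0))
    where
    3M+n≡ : M + (M + M) + n ≡ n + M * 3
    3M+n≡ = trans (+-comm (M + (M + M)) n) (cong (n +_) (triple M))
      where triple : ∀ M → M + (M + M) ≡ M * 3
            triple = solve-∀
    %M : (M + (M + M) + n) % M ≡ n % M
    %M = trans (cong (_% M) (trans 3M+n≡ (cong (n +_) (*-comm M 3)))) ([m+kn]%n≡m%n n 3 M)
    %3 : (M + (M + M) + n) % 3 ≡ n % 3
    %3 = trans (cong (_% 3) 3M+n≡) ([m+kn]%n≡m%n n M 3)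

  count-block : (f : ℕ → ℕ) → (∀ i → f i % M ≡ i % M) →
                count (λ i → member? (f i)) M ≡ 𝟙[3∤] (f r)
  count-block f f-preserves = trans (count-unique (λ i → member? (f i)) r r<M only-r)
                                    (𝟙-cong Member[f[r]]⇔ (member? (f r)) (¬? (f r % 3 ≟ 0)))
    where
    only-r : ∀ i → i < M → Member (f i) → i ≡ r
    only-r i i<M (≡r , _) = trans (sym (m<n⇒m%n≡m i<M)) (trans (sym (f-preserves i)) ≡r)
    Member[f[r]]⇔ : Member (f r) ⇔ (f r % 3 ≢ 0)
    Member[f[r]]⇔ = mk⇔ proj₂ (λ ≢0 → trans (f-preserves r) (m<n⇒m%n≡m r<M) , ≢0)

  count-period : count member? (M + (M + M)) ≡ 2
  count-period = begin
    count member? (M + (M + M))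
      ≡⟨ count-+ member? M (M + M) ⟩
    count member? M + count (λ i → member? (M + i)) (M + M)
      ≡⟨ cong (count member? M +_) (count-+ (λ i → member? (M + i)) M M) ⟩
    count member? M + (count (λ i → member? (M + i)) M + count (λ i → member? (M + (M + i))) M)
      ≡⟨ cong₂ _+_ block₀ (cong₂ _+_ block₁ block₂) ⟩
    𝟙[3∤] r + (𝟙[3∤] (M + r) + 𝟙[3∤] (M + (M + r)))
      ≡⟨ 𝟙[3∤]-three-translates M r M%3 ⟩
    2 ∎
    where
    open ≡-Reasoning
    block₀ : count member? M ≡ 𝟙[3∤] r
    block₀ = count-block id (λ _ → refl)
    block₁ : count (λ i → member? (M + i)) M ≡ 𝟙[3∤] (M + r)
    block₁ = count-block (M +_) [M+n]%M≡n%M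
    block₂ : count (λ i → member? (M + (M + i))) M ≡ 𝟙[3∤] (M + (M + r))
    block₂ = count-block (λ i → M + (M + i)) (λ i → trans ([M+n]%M≡n%M (M + i)) ([M+n]%M≡n%M i))

∣6⇒≡1⊎2∣⊎3∣ : ∀ {d} → d ∣ 6 → d ≡ 1 ⊎ 2 ∣ d ⊎ 3 ∣ d
∣6⇒≡1⊎2∣⊎3∣ {d} d∣6 = go d d∣6 (∣⇒≤ d∣6)
  where
  go : ∀ d → d ∣ 6 → d ≤ 6 → d ≡ 1 ⊎ 2 ∣ d ⊎ 3 ∣ d
  go 0 0∣6 _ = ⊥-elim (from-no (0 ∣? 6) 0∣6)
  go 1 _   _ = inj₁ refl
  go 2 _   _ = inj₂ (inj₁ (divides 1 refl))
  go 3 _   _ = inj₂ (inj₂ (divides 1 refl))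
  go 4 _   _ = inj₂ (inj₁ (divides 2 refl))
  go 5 5∣6 _ = ⊥-elim (from-no (5 ∣? 6) 5∣6)
  go 6 _   _ = inj₂ (inj₁ (divides 3 refl))
  go (suc (suc (suc (suc (suc (suc (suc _))))))) _ (s≤s (s≤s (s≤s (s≤s (s≤s (s≤s ()))))))

gcd[n,6]≡1⇔ : ∀ n → gcd n 6 ≡ 1 ⇔ (n % 2 ≡ 1 × n % 3 ≢ 0)
gcd[n,6]≡1⇔ n = mk⇔ to from
  where
  gcd≡1⇒%p≢0 : ∀ {p} .{{_ : NonZero p}} → p ∣ 6 → 1 < p → gcd n 6 ≡ 1 → n % p ≢ 0
  gcd≡1⇒%p≢0 {suc (suc _)} p∣6 (s≤s (s≤s _)) gcd≡1 n%p≡0 =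
    1+n≢0 (suc-injective (∣1⇒≡1 (subst (_ ∣_) gcd≡1 (gcd-greatest (m%n≡0⇒n∣m n _ n%p≡0) p∣6))))
  to : gcd n 6 ≡ 1 → n % 2 ≡ 1 × n % 3 ≢ 0
  to gcd≡1 = n%2≢0⇒n%2≡1 n (gcd≡1⇒%p≢0 (divides 3 refl) (s≤s (s≤s z≤n)) gcd≡1)
           , gcd≡1⇒%p≢0 (divides 2 refl) (s≤s (s≤s z≤n)) gcd≡1
  from : n % 2 ≡ 1 × n % 3 ≢ 0 → gcd n 6 ≡ 1
  from (n-odd , n%3≢0) = coprime⇒gcd≡1 coprime
    where
    coprime : Coprime n 6
    coprime (d∣n , d∣6) with ∣6⇒≡1⊎2∣⊎3∣ d∣6
    ... | inj₁ d≡1        = d≡1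
    ... | inj₂ (inj₁ 2∣d) = ⊥-elim (0≢1+n (trans (sym (n∣m⇒m%n≡0 n 2 (∣-trans 2∣d d∣n))) n-odd))
    ... | inj₂ (inj₂ 3∣d) = ⊥-elim (n%3≢0 (n∣m⇒m%n≡0 n 3 (∣-trans 3∣d d∣n)))

Σ-condition⇔ : ∀ {k} (os : Vec ℕ k) {M r} .{{_ : NonZero M}} →
               (∀ n → (n % 2 ≡ 1 × V k n ≡ os) ⇔ n % M ≡ r) →
               ∀ n → (1 ≤ n × (gcd n 6 ≡ 1 × V k n ≡ os)) ⇔ (n % M ≡ r × n % 3 ≢ 0)
Σ-condition⇔ {k} os {M} {r} class n = mk⇔ to from
  where
  module C = Equivalence (class n)
  module G = Equivalence (gcd[n,6]≡1⇔ n)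
  to : 1 ≤ n × (gcd n 6 ≡ 1 × V k n ≡ os) → n % M ≡ r × n % 3 ≢ 0
  to (_ , gcd≡1 , V≡) = let n-odd , n%3≢0 = G.to gcd≡1 in C.to (n-odd , V≡) , n%3≢0
  from : n % M ≡ r × n % 3 ≢ 0 → 1 ≤ n × (gcd n 6 ≡ 1 × V k n ≡ os)
  from (n%M≡r , n%3≢0) = let n-odd , V≡ = C.from n%M≡r in
    n≢0⇒n>0 (λ { refl → 0≢1+n n-odd }) , G.from (n-odd , n%3≢0) , V≡

-- Densities

ℤ∣m⊖n∣≡∣m-n∣ : ∀ m n → ℤ.∣ m ⊖ n ∣ ≡ ∣ m - n ∣
ℤ∣m⊖n∣≡∣m-n∣ m n with ≤-total m n
... | inj₁ m≤n = trans (ℤ.∣⊖∣-≤ m≤n) (sym (m≤n⇒∣m-n∣≡n∸m m≤n))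
... | inj₂ n≤m = trans (cong ℤ.∣_∣ (ℤ.⊖-≥ n≤m)) (sym (m≤n⇒∣n-m∣≡n∸m n≤m))

Π-density-from-error-bound : ∀ (f : ℕ → ℕ) D .{{_ : NonZero D}} B {d : ℚ} →
                             toℚᵘ d ≃ᵘ mkℚᵘ (ℤ.+ 1) (pred D) →
                             (∀ m → ∣ 3 * f (suc m) * D - suc m ∣ ≤ B) → HasΠDensity f d
Π-density-from-error-bound f D B {d} d≃1/D error (mkℚ +[1+ p-1 ] q-1 _) _ =
  B * q , λ m Bq≤m →
    ℚ.toℚᵘ-cancel-< (ℚᵘ.<-respˡ-≃ (ℚᵘ.≃-sym (distance≃ m)) (distance< m Bq≤m))
  where
  p = suc p-1
  q = suc q-1
  D′ = suc (pred D)
  x : ℕ → ℚᵘ.ℚᵘ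
  x m = mkℚᵘ (ℤ.+ (3 * f (suc m))) m
  distance≃ : ∀ m → toℚᵘ ℚ.∣ (ℤ.+ (3 * f (suc m))) ℚ./ suc m ℚ.- d ∣
                    ≃ᵘ ℚᵘ.∣ x m ℚᵘ.- mkℚᵘ (ℤ.+ 1) (pred D) ∣
  distance≃ m = ℚᵘ.≃-trans (ℚ.toℚᵘ-homo-∣-∣ _) (ℚᵘ.∣-∣-cong
    (ℚᵘ.≃-trans (ℚ.toℚᵘ-homo-+ ((ℤ.+ (3 * f (suc m))) ℚ./ suc m) (ℚ.- d))
                (ℚᵘ.+-cong (ℚ.toℚᵘ-fromℚᵘ (x m))
                           (ℚᵘ.≃-trans (ℚ.toℚᵘ-homo‿- d) (ℚᵘ.-‿cong d≃1/D)))))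
  distance< : ∀ m → B * q ≤ m →
              ℚᵘ.∣ x m ℚᵘ.- mkℚᵘ (ℤ.+ 1) (pred D) ∣ <ᵘ mkℚᵘ +[1+ p-1 ] q-1
  distance< m Bq≤m = *<* (subst₂ ℤ._<_ (ℤ.pos-* z q) (ℤ.pos-* p (suc m * D′)) (ℤ.+<+ z*q<p*[T*D]))
    where
    a = 3 * f (suc m)
    z = ℤ.∣ ℤ.+ a ℤ.* ℤ.+ D′ ℤ.+ -[1+ 0 ] ℤ.* ℤ.+ suc m ∣
    z≡ : ℤ.+ a ℤ.* ℤ.+ D′ ℤ.+ -[1+ 0 ] ℤ.* ℤ.+ suc m ≡ a * D′ ⊖ suc m
    z≡ = trans (cong₂ ℤ._+_ (sym (ℤ.pos-* a D′)) (ℤ.-1*i≡-i (ℤ.+ suc m))) (ℤ.m-n≡m⊖n (a * D′) (suc m))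
    z≤B : z ≤ B
    z≤B = begin
      z                        ≡⟨ cong ℤ.∣_∣ z≡ ⟩
      ℤ.∣ a * D′ ⊖ suc m ∣     ≡⟨ ℤ∣m⊖n∣≡∣m-n∣ (a * D′) (suc m) ⟩
      ∣ a * D′ - suc m ∣       ≡⟨ cong (λ n → ∣ a * n - suc m ∣) (suc-pred D) ⟩
      ∣ a * D - suc m ∣        ≤⟨ error m ⟩
      B                        ∎
      where open ≤-Reasoning
    z*q<p*[T*D] : z * q < p * (suc m * D′)
    z*q<p*[T*D] = begin-strict
      z * q                    ≤⟨ *-monoˡ-≤ q z≤B ⟩
      B * q                    ≤⟨ Bq≤m ⟩
      m                        <⟨ n<1+n m ⟩
      suc m                    ≤⟨ m≤m*n (suc m) D′ ⟩
      suc m * D′               ≤⟨ m≤n*m (suc m * D′) p ⟩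
      p * (suc m * D′)         ∎
      where open ≤-Reasoning
Π-density-from-error-bound f D B _ _ (mkℚ (ℤ.+ 0)  _ _) (ℚ.*<* (ℤ.+<+ ()))
Π-density-from-error-bound f D B _ _ (mkℚ -[1+ _ ] _ _) (ℚ.*<* ())

toℚᵘ-½^n : ∀ n → toℚᵘ (½ ^ℚ n) ≃ᵘ mkℚᵘ (ℤ.+ 1) (pred (2 ^ n))
toℚᵘ-½^n zero    = ℚᵘ.≃-refl
toℚᵘ-½^n (suc n) = ℚᵘ.≃-trans (ℚ.toℚᵘ-homo-* ½ (½ ^ℚ n))
  (ℚᵘ.≃-trans (ℚᵘ.*-congˡ {toℚᵘ ½} (toℚᵘ-½^n n))
    (ℚᵘ.≃-reflexive (cong (λ m → mkℚᵘ (ℤ.+ 1) (pred (2 * m))) (suc-pred (2 ^ n) {{m^n≢0 2 n}}))))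

countΣ-density : ∀ {k} (os : Vec ℕ k) → All (1 ≤_) os → HasΠDensity (countΣ os) (½ ^ℚ vsum os)
countΣ-density {k} os os≥1 = Π-density-from-error-bound (countΣ os) D (suc L) (toℚᵘ-½^n s) error
  where
  s = vsum os
  D = 2 ^ s
  M = 2 ^ suc s
  instance
    _ = m^n≢0 2 s
    _ = m^n≢0 2 (suc s)
  class = V-residueClass os os≥1
  open PrimeTo3InResidueClass M (2^n%3≡1⊎2 (suc s)) (proj₁ (proj₂ class))
  L = M + (M + M)
  instance _ = >-nonZero (≤-trans (>-nonZero⁻¹ M) (m≤m+n M (M + M)))

  Σ-condition⇔Member : ∀ n → (1 ≤ n × (gcd n 6 ≡ 1 × V k n ≡ os)) ⇔ Member n
  Σ-condition⇔Member = Σ-condition⇔ os (proj₂ (proj₂ class))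

  countΣ≡count : ∀ t → countΣ os t ≡ count member? (suc t)
  countΣ≡count t = trans
    (cong length (filter-≐ (λ n → (1 ≤? n) ×-dec ((gcd n 6 ≟ 1) ×-dec Vec.≡-dec _≟_ (V k n) os)) member?
                           ((λ {n} → Equivalence.to (Σ-condition⇔Member n)) ,
                            (λ {n} → Equivalence.from (Σ-condition⇔Member n)))
                           (upTo (suc t))))
    (length-filter-applyUpTo member? id (suc t))

  approx : ∀ T → ∣ count member? T * (3 * D) - T ∣ ≤ L
  approx = count-approx member? L (3 * D) Member-periodic (trans (cong (_* (3 * D)) count-period) (2*3D≡L D))
    where 2*3D≡L : ∀ D → 2 * (3 * D) ≡ 2 * D + (2 * D + 2 * D)
          2*3D≡L = solve-∀

  error : ∀ m → ∣ 3 * countΣ os (suc m) * D - suc m ∣ ≤ suc L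
  error m = begin
    ∣ 3 * countΣ os (suc m) * D - suc m ∣
      ≡⟨ cong (∣_- suc m ∣) (trans (cong (λ c → 3 * c * D) (countΣ≡count (suc m))) (rearrange c D)) ⟩
    ∣ c * (3 * D) - suc m ∣
      ≤⟨ ∣-∣-triangle (c * (3 * D)) (suc (suc m)) (suc m) ⟩
    ∣ c * (3 * D) - suc (suc m) ∣ + ∣ suc (suc m) - suc m ∣
      ≤⟨ +-mono-≤ (approx (suc (suc m))) (≤-reflexive ∣2+m-1+m∣≡1) ⟩
    L + 1
      ≡⟨ +-comm L 1 ⟩
    suc L ∎
    where
    open ≤-Reasoning
    c = count member? (suc (suc m))
    ∣2+m-1+m∣≡1 : ∣ suc (suc m) - suc m ∣ ≡ 1
    ∣2+m-1+m∣≡1 = trans (m≤n⇒∣n-m∣≡n∸m (n≤1+n m)) (m+n∸n≡m 1 m)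
    rearrange : ∀ c D → 3 * c * D ≡ c * (3 * D)
    rearrange = solve-∀

-- Geometric distribution

½^[m+n]≡½^m*½^n : ∀ m n → ½ ^ℚ (m + n) ≡ ½ ^ℚ m ℚ.* ½ ^ℚ n
½^[m+n]≡½^m*½^n zero    n = sym (ℚ.*-identityˡ (½ ^ℚ n))
½^[m+n]≡½^m*½^n (suc m) n =
  trans (cong (½ ℚ.*_) (½^[m+n]≡½^m*½^n m n)) (sym (ℚ.*-assoc ½ (½ ^ℚ m) (½ ^ℚ n)))

jointGeomPMF≡½^vsum : ∀ {k} (os : Vec ℕ k) → All (1 ≤_) os → jointGeomPMF os ≡ ½ ^ℚ vsum os
jointGeomPMF≡½^vsum []           []         = refl
jointGeomPMF≡½^vsum (suc o ∷ os) (_ ∷ os≥1) =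
  trans (cong₂ ℚ._*_ (ℚ.*-comm (½ ^ℚ o) ½) (jointGeomPMF≡½^vsum os os≥1))
        (sym (½^[m+n]≡½^m*½^n (suc o) (vsum os)))

theorem5p3 : (k : ℕ) → 1 ≤ k → (os : Vec ℕ k) → All (1 ≤_) os →
    HasΠDensity (countΣ os) (½ ^ℚ vsum os)
    × HasΠDensity (countΣ os) (jointGeomPMF os)
theorem5p3 _ _ os os≥1 = density , subst (HasΠDensity (countΣ os)) (sym (jointGeomPMF≡½^vsum os os≥1)) density
  where
  density : HasΠDensity (countΣ os) (½ ^ℚ vsum os)
  density = countΣ-density os os≥1
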